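{- Let $m\ge 1$, $p,q\ge 0$ with $p+q>1$, and $r,s\ge 0$ be integers, and let $n\ge 1$. Then: (i) if $q=0$, $$G_{n,p,0}^{r,s,m}=G_{n+r,p,0}^{0,0,m}-G_{r,p,0}^{0,0,m}-\sum_{i=1}^{r}R_{n,m,p}^{i,r};$$ (ii) if $p>q$ and $r\neq s$, $$G_{n,p,q}^{r,s,m}=\frac{1}{(s-r)^{q}}\sum_{i=0}^{q}(-1)^{i}\binom{q}{i}G_{n,p-i,i}^{r,s,m};$$ (iii) if $p<q$ and $r\neq s$, $$G_{n,p,q}^{r,s,m}=\frac{1}{(r-s)^{p}}\sum_{i=0}^{p}(-1)^{i}\binom{p}{i}G_{n,i,q-i}^{r,s,m}.$$
   Context: For integers $j\ge 0$, $m\ge1$, $H_{j,m}=\sum_{i=1}^{j}i^{ -m}$ (so $H_{0,m}=0$); empty sums are $0$. For integers $N\ge0$, $p,q\ge0$, $r,s\ge0$: $G_{N,p,q}^{r,s,m}=\sum_{j=1}^{N}\frac{H_{j,m}}{(j+r)^{p}(j+s)^{q}}$ and $R_{N,p,q}^{r,s}=\sum_{j=1}^{N}\frac{1}{(j+r)^{p}(j+s)^{q}}$. -}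

module Defs where

open import Data.Nat as ℕ using (ℕ; zero; suc)
open import Data.Integer as ℤ using (ℤ; +_; -[1+_])
open import Data.Rational using (ℚ; 0ℚ; _/_; _+_; _*_)

-- reciprocal of a natural number as a rational (convention: 1/0 := 0;
-- it is only ever applied to positive arguments below)
recipℕ : ℕ → ℚ
recipℕ zero    = 0ℚ
recipℕ (suc k) = + 1 / suc k

-- reciprocal of an integer as a rational (convention: 1/0 := 0;
-- only applied to nonzero arguments in the theorem)
recipℤ : ℤ → ℚ
recipℤ (+ zero)    = 0ℚ
recipℤ (+ (suc k)) = + 1 / suc k
recipℤ -[1+ k ]    = -[1+ 0 ] / suc k

ℤtoℚ : ℤ → ℚ
ℤtoℚ z = z / 1

sum1 : ℕ → (ℕ → ℚ) → ℚ
sum1 zero    f = 0ℚ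
sum1 (suc N) f = sum1 N f + f (suc N)

sum0 : ℕ → (ℕ → ℚ) → ℚ
sum0 zero    f = f 0
sum0 (suc N) f = sum0 N f + f (suc N)

H : ℕ → ℕ → ℚ
H j m = sum1 j (λ i → recipℕ (i ℕ.^ m))

G : (N p q r s m : ℕ) → ℚ
G N p q r s m = sum1 N (λ j → H j m * recipℕ (((j ℕ.+ r) ℕ.^ p) ℕ.* ((j ℕ.+ s) ℕ.^ q)))

R : (N p q r s : ℕ) → ℚ
R N p q r s = sum1 N (λ j → recipℕ (((j ℕ.+ r) ℕ.^ p) ℕ.* ((j ℕ.+ s) ℕ.^ q)))

-- With x = 1/(j+r) and y = 1/(j+s) one has x y = (x − y)/(s − r), so for q ≤ p
-- x^p y^q = x^(p−q) (x y)^q = (s − r)^(−q) x^(p−q) (x − y)^q, and expanding (x − y)^q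
-- by the binomial theorem, multiplying by H_{j,m} and summing over j gives (ii); (iii)
-- is (ii) with the roles of (p, r) and (q, s) exchanged. For (i), H_{j,m} =
-- H_{j+r,m} − Σ_{i=1}^{r} (j+i)^(−m), and summing H_{j+r,m}/(j+r)^p over 1 ≤ j ≤ n
-- is G_{n+r} − G_r.
module Submission where

open import Defs
open import Data.Nat as ℕ using (ℕ; _≤_; _<_)
open import Data.Nat.Combinatorics using (_C_)
open import Data.Integer as ℤ using (+_; -[1+_])
open import Data.Rational using (ℚ; _+_; _-_; _*_)
open import Data.Product using (_×_)
open import Relation.Binary.PropositionalEquality using (_≡_; _≢_)

open import Data.Nat using (zero; suc)
import Data.Nat.Properties as ℕP
import Data.Integer.Properties as ℤP
import Data.Integer.Tactic.RingSolver as ℤSolver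
open import Data.Rational using (0ℚ; 1ℚ; -_; toℚᵘ)
open import Data.Rational.Properties
import Data.Rational.Unnormalised as ℚᵘ
import Data.Rational.Unnormalised.Properties as ℚᵘP
open import Data.Rational.Solver using (module +-*-Solver)
open import Data.Fin using (toℕ)
open import Data.Product using (_,_)
open import Algebra.Bundles using (CommutativeSemiring; CommutativeRing)
open import Relation.Binary.PropositionalEquality
  using (refl; sym; trans; cong; cong₂; module ≡-Reasoning)

open +-*-Solver

ℚ-commutativeSemiring : CommutativeSemiring _ _
ℚ-commutativeSemiring = CommutativeRing.commutativeSemiring +-*-commutativeRing

open import Algebra.Properties.CommutativeSemiring.Exp ℚ-commutativeSemiring
  using (_^_; ^-homo-*; ^-distrib-*)
import Algebra.Properties.CommutativeSemiring.Binomial ℚ-commutativeSemiring as Binomial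
open import Algebra.Definitions.RawMonoid (CommutativeSemiring.+-rawMonoid ℚ-commutativeSemiring)
  using (sum) renaming (_×_ to _×ℚ_)

sum1-cong : ∀ n {f g : ℕ → ℚ} → (∀ j → f (suc j) ≡ g (suc j)) → sum1 n f ≡ sum1 n g
sum1-cong zero    f≗g = refl
sum1-cong (suc n) f≗g = cong₂ _+_ (sum1-cong n f≗g) (f≗g n)

sum1-zero : ∀ n → sum1 n (λ _ → 0ℚ) ≡ 0ℚ
sum1-zero zero    = refl
sum1-zero (suc n) = trans (+-identityʳ _) (sum1-zero n)

sum1-+ : ∀ n (f g : ℕ → ℚ) → sum1 n (λ j → f j + g j) ≡ sum1 n f + sum1 n g
sum1-+ zero    f g = sym (+-identityʳ 0ℚ)
sum1-+ (suc n) f g = trans (cong (_+ (f (suc n) + g (suc n))) (sum1-+ n f g))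
  (solve 4 (λ a b c d → (a :+ b) :+ (c :+ d) := (a :+ c) :+ (b :+ d)) refl
    (sum1 n f) (sum1 n g) (f (suc n)) (g (suc n)))

sum1-- : ∀ n (f g : ℕ → ℚ) → sum1 n (λ j → f j - g j) ≡ sum1 n f - sum1 n g
sum1-- zero    f g = refl
sum1-- (suc n) f g = trans (cong (_+ (f (suc n) - g (suc n))) (sum1-- n f g))
  (solve 4 (λ a b c d → (a :- b) :+ (c :- d) := (a :+ c) :- (b :+ d)) refl
    (sum1 n f) (sum1 n g) (f (suc n)) (g (suc n)))

*-distribˡ-sum1 : ∀ n c (f : ℕ → ℚ) → c * sum1 n f ≡ sum1 n (λ j → c * f j)
*-distribˡ-sum1 zero    c f = *-zeroʳ c
*-distribˡ-sum1 (suc n) c f = trans (*-distribˡ-+ c (sum1 n f) (f (suc n)))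
  (cong (_+ c * f (suc n)) (*-distribˡ-sum1 n c f))

sum1-split : ∀ n r (f : ℕ → ℚ) → sum1 (n ℕ.+ r) f ≡ sum1 r f + sum1 n (λ j → f (j ℕ.+ r))
sum1-split zero    r f = sym (+-identityʳ _)
sum1-split (suc n) r f = trans (cong (_+ f (suc (n ℕ.+ r))) (sum1-split n r f))
  (+-assoc (sum1 r f) (sum1 n (λ j → f (j ℕ.+ r))) _)

sum1-comm : ∀ k n (F : ℕ → ℕ → ℚ) →
  sum1 k (λ i → sum1 n (F i)) ≡ sum1 n (λ j → sum1 k (λ i → F i j))
sum1-comm zero    n F = sym (sum1-zero n)
sum1-comm (suc k) n F = trans (cong (_+ sum1 n (F (suc k))) (sum1-comm k n F))
  (sym (sum1-+ n _ _))

sum0-cong : ∀ N {f g : ℕ → ℚ} → (∀ i → i ≤ N → f i ≡ g i) → sum0 N f ≡ sum0 N g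
sum0-cong zero    f≗g = f≗g 0 ℕ.z≤n
sum0-cong (suc N) f≗g = cong₂ _+_ (sum0-cong N (λ i i≤N → f≗g i (ℕP.m≤n⇒m≤1+n i≤N)))
  (f≗g (suc N) ℕP.≤-refl)

*-distribˡ-sum0 : ∀ N c (f : ℕ → ℚ) → c * sum0 N f ≡ sum0 N (λ i → c * f i)
*-distribˡ-sum0 zero    c f = refl
*-distribˡ-sum0 (suc N) c f = trans (*-distribˡ-+ c (sum0 N f) (f (suc N)))
  (cong (_+ c * f (suc N)) (*-distribˡ-sum0 N c f))

sum0-sum1-comm : ∀ N n (F : ℕ → ℕ → ℚ) →
  sum0 N (λ i → sum1 n (F i)) ≡ sum1 n (λ j → sum0 N (λ i → F i j))
sum0-sum1-comm zero    n F = refl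
sum0-sum1-comm (suc N) n F = trans (cong (_+ sum1 n (F (suc N))) (sum0-sum1-comm N n F))
  (sym (sum1-+ n _ _))

sum0-suc : ∀ N (f : ℕ → ℚ) → sum0 (suc N) f ≡ f 0 + sum0 N (λ i → f (suc i))
sum0-suc zero    f = refl
sum0-suc (suc N) f = trans (cong (_+ f (suc (suc N))) (sum0-suc N f))
  (+-assoc (f 0) (sum0 N (λ i → f (suc i))) (f (suc (suc N))))

sum0≡sum : ∀ N (f : ℕ → ℚ) → sum0 N f ≡ sum {suc N} (λ k → f (toℕ k))
sum0≡sum zero    f = sym (+-identityʳ (f 0))
sum0≡sum (suc N) f = trans (sum0-suc N f) (cong (λ z → f 0 + z) (sum0≡sum N (λ i → f (suc i))))

ℤtoℚ≃mkℚᵘ : ∀ z → toℚᵘ (ℤtoℚ z) ℚᵘ.≃ ℚᵘ.mkℚᵘ z 0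
ℤtoℚ≃mkℚᵘ z = toℚᵘ-fromℚᵘ (ℚᵘ.mkℚᵘ z 0)

ℤtoℚ-homo-+ : ∀ a b → ℤtoℚ (a ℤ.+ b) ≡ ℤtoℚ a + ℤtoℚ b
ℤtoℚ-homo-+ a b = toℚᵘ-injective (ℚᵘP.≃-trans (ℤtoℚ≃mkℚᵘ (a ℤ.+ b))
  (ℚᵘP.≃-sym (ℚᵘP.≃-trans (toℚᵘ-homo-+ (ℤtoℚ a) (ℤtoℚ b))
    (ℚᵘP.≃-trans (ℚᵘP.+-cong (ℤtoℚ≃mkℚᵘ a) (ℤtoℚ≃mkℚᵘ b))
      (ℚᵘP.≃-reflexive (cong (λ z → ℚᵘ.mkℚᵘ z 0)
        (cong₂ ℤ._+_ (ℤP.*-identityʳ a) (ℤP.*-identityʳ b))))))))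

ℤtoℚ-homo-* : ∀ a b → ℤtoℚ (a ℤ.* b) ≡ ℤtoℚ a * ℤtoℚ b
ℤtoℚ-homo-* a b = toℚᵘ-injective (ℚᵘP.≃-trans (ℤtoℚ≃mkℚᵘ (a ℤ.* b))
  (ℚᵘP.≃-sym (ℚᵘP.≃-trans (toℚᵘ-homo-* (ℤtoℚ a) (ℤtoℚ b))
    (ℚᵘP.*-cong (ℤtoℚ≃mkℚᵘ a) (ℤtoℚ≃mkℚᵘ b)))))

ℤtoℚ-homo-^ : ∀ z i → ℤtoℚ (z ℤ.^ i) ≡ ℤtoℚ z ^ i
ℤtoℚ-homo-^ z zero    = refl
ℤtoℚ-homo-^ z (suc i) = trans (ℤtoℚ-homo-* z (z ℤ.^ i)) (cong (ℤtoℚ z *_) (ℤtoℚ-homo-^ z i))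

recipℤ-inverse : ∀ z .{{_ : ℤ.NonZero z}} → recipℤ z * ℤtoℚ z ≡ 1ℚ
recipℤ-inverse (+ suc k) = toℚᵘ-injective (ℚᵘP.≃-trans
  (toℚᵘ-homo-* (recipℤ (+ suc k)) (ℤtoℚ (+ suc k)))
  (ℚᵘP.≃-trans (ℚᵘP.*-cong (toℚᵘ-fromℚᵘ (ℚᵘ.mkℚᵘ (+ 1) k)) (ℤtoℚ≃mkℚᵘ (+ suc k)))
    (ℚᵘ.*≡* (trans (ℤP.*-identityʳ _) (trans (ℤP.*-identityˡ _)
      (sym (trans (ℤP.*-identityˡ _) (cong +_ (ℕP.*-identityʳ (suc k))))))))))
recipℤ-inverse -[1+ k ]  = toℚᵘ-injective (ℚᵘP.≃-trans
  (toℚᵘ-homo-* (recipℤ -[1+ k ]) (ℤtoℚ -[1+ k ]))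
  (ℚᵘP.≃-trans (ℚᵘP.*-cong (toℚᵘ-fromℚᵘ (ℚᵘ.mkℚᵘ -[1+ 0 ] k)) (ℤtoℚ≃mkℚᵘ -[1+ k ]))
    (ℚᵘ.*≡* (trans (ℤP.*-identityʳ _) (trans (ℤP.-1*i≡-i -[1+ k ])
      (sym (trans (ℤP.*-identityˡ _) (cong +_ (ℕP.*-identityʳ (suc k))))))))))

inverse-unique : ∀ {x y w : ℚ} → x * w ≡ 1ℚ → y * w ≡ 1ℚ → x ≡ y
inverse-unique {x} {y} {w} xw≡1 yw≡1 = begin
  x             ≡⟨ sym (*-identityʳ x) ⟩
  x * 1ℚ        ≡⟨ cong (x *_) (sym yw≡1) ⟩
  x * (y * w)   ≡⟨ solve 3 (λ x y w → x :* (y :* w) := y :* (x :* w)) refl x y w ⟩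
  y * (x * w)   ≡⟨ cong (y *_) xw≡1 ⟩
  y * 1ℚ        ≡⟨ *-identityʳ y ⟩
  y             ∎
  where open ≡-Reasoning

recipℤ-*-nonZero : ∀ a b .{{_ : ℤ.NonZero a}} .{{_ : ℤ.NonZero b}} →
  recipℤ (a ℤ.* b) ≡ recipℤ a * recipℤ b
recipℤ-*-nonZero a b = inverse-unique
  (recipℤ-inverse (a ℤ.* b) {{ℤP.i*j≢0 a b}})
  (begin
    (recipℤ a * recipℤ b) * ℤtoℚ (a ℤ.* b)         ≡⟨ cong (recipℤ a * recipℤ b *_) (ℤtoℚ-homo-* a b) ⟩
    (recipℤ a * recipℤ b) * (ℤtoℚ a * ℤtoℚ b)      ≡⟨ solve 4 (λ x y X Y → (x :* y) :* (X :* Y) := (x :* X) :* (y :* Y)) refl (recipℤ a) (recipℤ b) (ℤtoℚ a) (ℤtoℚ b) ⟩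
    (recipℤ a * ℤtoℚ a) * (recipℤ b * ℤtoℚ b)      ≡⟨ cong₂ _*_ (recipℤ-inverse a) (recipℤ-inverse b) ⟩
    1ℚ * 1ℚ                                         ≡⟨ *-identityˡ 1ℚ ⟩
    1ℚ                                              ∎)
  where open ≡-Reasoning

-- With the junk value recipℤ 0 = 0 the identity also holds when a factor vanishes.
recipℤ-* : ∀ a b → recipℤ (a ℤ.* b) ≡ recipℤ a * recipℤ b
recipℤ-* (+ zero) b = sym (*-zeroˡ (recipℤ b))
recipℤ-* a (+ zero) rewrite ℤP.*-zeroʳ a = sym (*-zeroʳ (recipℤ a))
recipℤ-* a@(+ suc _)  b@(+ suc _)  = recipℤ-*-nonZero a b
recipℤ-* a@(+ suc _)  b@(-[1+ _ ]) = recipℤ-*-nonZero a b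
recipℤ-* a@(-[1+ _ ]) b@(+ suc _)  = recipℤ-*-nonZero a b
recipℤ-* a@(-[1+ _ ]) b@(-[1+ _ ]) = recipℤ-*-nonZero a b

recipℤ-^ : ∀ z q → recipℤ (z ℤ.^ q) ≡ recipℤ z ^ q
recipℤ-^ z zero    = refl
recipℤ-^ z (suc q) = trans (recipℤ-* z (z ℤ.^ q)) (cong (recipℤ z *_) (recipℤ-^ z q))

recipℕ≡recipℤ : ∀ k → recipℕ k ≡ recipℤ (+ k)
recipℕ≡recipℤ zero    = refl
recipℕ≡recipℤ (suc k) = refl

recipℕ-* : ∀ a b → recipℕ (a ℕ.* b) ≡ recipℕ a * recipℕ b
recipℕ-* a b = begin
  recipℕ (a ℕ.* b)          ≡⟨ recipℕ≡recipℤ (a ℕ.* b) ⟩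
  recipℤ (+ (a ℕ.* b))      ≡⟨ cong recipℤ (ℤP.pos-* a b) ⟩
  recipℤ (+ a ℤ.* + b)      ≡⟨ recipℤ-* (+ a) (+ b) ⟩
  recipℤ (+ a) * recipℤ (+ b) ≡⟨ sym (cong₂ _*_ (recipℕ≡recipℤ a) (recipℕ≡recipℤ b)) ⟩
  recipℕ a * recipℕ b       ∎
  where open ≡-Reasoning

recipℕ-^ : ∀ a q → recipℕ (a ℕ.^ q) ≡ recipℕ a ^ q
recipℕ-^ a zero    = refl
recipℕ-^ a (suc q) = trans (recipℕ-* a (a ℕ.^ q)) (cong (recipℕ a *_) (recipℕ-^ a q))

recipℕ-^*^ : ∀ a b p q → recipℕ (a ℕ.^ p ℕ.* b ℕ.^ q) ≡ recipℕ a ^ p * recipℕ b ^ q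
recipℕ-^*^ a b p q = trans (recipℕ-* (a ℕ.^ p) (b ℕ.^ q)) (cong₂ _*_ (recipℕ-^ a p) (recipℕ-^ b q))

inverses-partial-fraction : ∀ {x X y Y e D : ℚ} →
  x * X ≡ 1ℚ → y * Y ≡ 1ℚ → e * D ≡ 1ℚ → Y ≡ X + D → x * y ≡ e * (x - y)
inverses-partial-fraction {x} {X} {y} {Y} {e} {D} xX≡1 yY≡1 eD≡1 Y≡X+D = sym (begin
  e * (x - y)                              ≡⟨ cong₂ (λ u v → e * (u - v)) (sym (*-identityʳ x)) (sym (*-identityʳ y)) ⟩
  e * (x * 1ℚ - y * 1ℚ)                    ≡⟨ cong₂ (λ u v → e * (x * u - y * v)) (sym yY≡1) (sym xX≡1) ⟩
  e * (x * (y * Y) - y * (x * X))          ≡⟨ cong (λ u → e * (x * (y * u) - y * (x * X))) Y≡X+D ⟩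
  e * (x * (y * (X + D)) - y * (x * X))    ≡⟨ solve 5 (λ x y X e D → e :* (x :* (y :* (X :+ D)) :- y :* (x :* X)) := (x :* y) :* (e :* D)) refl x y X e D ⟩
  (x * y) * (e * D)                        ≡⟨ cong ((x * y) *_) eD≡1 ⟩
  (x * y) * 1ℚ                             ≡⟨ *-identityʳ (x * y) ⟩
  x * y                                    ∎)
  where open ≡-Reasoning

recipℕ-partial-fraction : ∀ t r s → r ≢ s →
  recipℕ (suc t ℕ.+ r) * recipℕ (suc t ℕ.+ s)
    ≡ recipℤ (+ s ℤ.- + r) * (recipℕ (suc t ℕ.+ r) - recipℕ (suc t ℕ.+ s))
recipℕ-partial-fraction t r s r≢s =
  inverses-partial-fraction {recipℕ a} {ℤtoℚ (+ a)} {recipℕ b} {ℤtoℚ (+ b)} {recipℤ d}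
    (recipℤ-inverse (+ a)) (recipℤ-inverse (+ b)) (recipℤ-inverse d {{ℤ.≢-nonZero d≢0}})
    (trans (cong ℤtoℚ b≡a+d) (ℤtoℚ-homo-+ (+ a) d))
  where
  a = suc t ℕ.+ r
  b = suc t ℕ.+ s
  d = + s ℤ.- + r
  d≢0 : d ≢ + 0
  d≢0 d≡0 = r≢s (sym (ℤP.+-injective (ℤP.i-j≡0⇒i≡j (+ s) (+ r) d≡0)))
  u+s≡[u+r]+[s-r] : ∀ u r s → u ℤ.+ s ≡ (u ℤ.+ r) ℤ.+ (s ℤ.- r)
  u+s≡[u+r]+[s-r] = ℤSolver.solve-∀
  b≡a+d : + b ≡ + a ℤ.+ d
  b≡a+d = trans (ℤP.pos-+ (suc t) s)
    (trans (u+s≡[u+r]+[s-r] (+ suc t) (+ r) (+ s)) (cong (ℤ._+ d) (sym (ℤP.pos-+ (suc t) r))))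

signedBinomial : ℕ → ℕ → ℚ
signedBinomial q i = ℤtoℚ ((-[1+ 0 ] ℤ.^ i) ℤ.* + (q C i))

×≡ℤtoℚ* : ∀ n t → n ×ℚ t ≡ ℤtoℚ (+ n) * t
×≡ℤtoℚ* zero    t = sym (*-zeroˡ t)
×≡ℤtoℚ* (suc n) t = begin
  t + n ×ℚ t                     ≡⟨ cong (λ z → t + z) (×≡ℤtoℚ* n t) ⟩
  t + ℤtoℚ (+ n) * t             ≡⟨ solve 2 (λ a t → t :+ a :* t := (con 1ℚ :+ a) :* t) refl (ℤtoℚ (+ n)) t ⟩
  (1ℚ + ℤtoℚ (+ n)) * t          ≡⟨ cong (_* t) (sym (ℤtoℚ-homo-+ (+ 1) (+ n))) ⟩
  ℤtoℚ (+ suc n) * t             ∎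
  where open ≡-Reasoning

binomial-difference : ∀ q x y →
  (x - y) ^ q ≡ sum0 q (λ i → signedBinomial q i * (x ^ (q ℕ.∸ i) * y ^ i))
binomial-difference q x y = begin
  (x - y) ^ q                                                      ≡⟨ cong (_^ q) (+-comm x (- y)) ⟩
  (- y + x) ^ q                                                    ≡⟨ Binomial.theorem q (- y) x ⟩
  sum {suc q} (λ k → (q C toℕ k) ×ℚ ((- y) ^ toℕ k * x ^ (q ℕ.∸ toℕ k)))
    ≡⟨ sym (sum0≡sum q (λ i → (q C i) ×ℚ ((- y) ^ i * x ^ (q ℕ.∸ i)))) ⟩
  sum0 q (λ i → (q C i) ×ℚ ((- y) ^ i * x ^ (q ℕ.∸ i)))            ≡⟨ sum0-cong q (λ i _ → term i) ⟩
  sum0 q (λ i → signedBinomial q i * (x ^ (q ℕ.∸ i) * y ^ i))      ∎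
  where
  open ≡-Reasoning
  -y≡-1*y : - y ≡ ℤtoℚ -[1+ 0 ] * y
  -y≡-1*y = trans (cong -_ (sym (*-identityˡ y))) (neg-distribˡ-* 1ℚ y)
  term : ∀ i → (q C i) ×ℚ ((- y) ^ i * x ^ (q ℕ.∸ i)) ≡ signedBinomial q i * (x ^ (q ℕ.∸ i) * y ^ i)
  term i = begin
    (q C i) ×ℚ ((- y) ^ i * x ^ (q ℕ.∸ i))                             ≡⟨ ×≡ℤtoℚ* (q C i) _ ⟩
    c * ((- y) ^ i * x ^ (q ℕ.∸ i))                                    ≡⟨ cong (λ z → c * (z * x ^ (q ℕ.∸ i))) (trans (cong (_^ i) -y≡-1*y) (^-distrib-* _ y i)) ⟩
    c * ((ℤtoℚ -[1+ 0 ] ^ i * y ^ i) * x ^ (q ℕ.∸ i))                   ≡⟨ solve 4 (λ c s a b → c :* ((s :* b) :* a) := (s :* c) :* (a :* b)) refl c (ℤtoℚ -[1+ 0 ] ^ i) (x ^ (q ℕ.∸ i)) (y ^ i) ⟩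
    (ℤtoℚ -[1+ 0 ] ^ i * c) * (x ^ (q ℕ.∸ i) * y ^ i)                   ≡⟨ cong (_* (x ^ (q ℕ.∸ i) * y ^ i)) (sym (trans (ℤtoℚ-homo-* (-[1+ 0 ] ℤ.^ i) (+ (q C i))) (cong (_* c) (ℤtoℚ-homo-^ -[1+ 0 ] i)))) ⟩
    signedBinomial q i * (x ^ (q ℕ.∸ i) * y ^ i)                        ∎
    where c = ℤtoℚ (+ (q C i))

^-*-^-partial-fractions : ∀ {x y c} p q → q ≤ p → x * y ≡ c * (x - y) →
  x ^ p * y ^ q ≡ c ^ q * sum0 q (λ i → signedBinomial q i * (x ^ (p ℕ.∸ i) * y ^ i))
^-*-^-partial-fractions {x} {y} {c} p q q≤p xy≡c[x-y] = begin
  x ^ p * y ^ q                                     ≡⟨ cong (λ k → x ^ k * y ^ q) (sym (ℕP.m∸n+n≡m q≤p)) ⟩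
  x ^ (p ℕ.∸ q ℕ.+ q) * y ^ q                       ≡⟨ cong (_* y ^ q) (^-homo-* x (p ℕ.∸ q) q) ⟩
  (x ^ (p ℕ.∸ q) * x ^ q) * y ^ q                   ≡⟨ *-assoc (x ^ (p ℕ.∸ q)) (x ^ q) (y ^ q) ⟩
  x ^ (p ℕ.∸ q) * (x ^ q * y ^ q)                   ≡⟨ cong (x ^ (p ℕ.∸ q) *_) (sym (^-distrib-* x y q)) ⟩
  x ^ (p ℕ.∸ q) * (x * y) ^ q                       ≡⟨ cong (λ z → x ^ (p ℕ.∸ q) * z ^ q) xy≡c[x-y] ⟩
  x ^ (p ℕ.∸ q) * (c * (x - y)) ^ q                 ≡⟨ cong (x ^ (p ℕ.∸ q) *_) (^-distrib-* c (x - y) q) ⟩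
  x ^ (p ℕ.∸ q) * (c ^ q * (x - y) ^ q)             ≡⟨ solve 3 (λ a b d → a :* (b :* d) := b :* (a :* d)) refl (x ^ (p ℕ.∸ q)) (c ^ q) ((x - y) ^ q) ⟩
  c ^ q * (x ^ (p ℕ.∸ q) * (x - y) ^ q)             ≡⟨ cong (λ z → c ^ q * (x ^ (p ℕ.∸ q) * z)) (binomial-difference q x y) ⟩
  c ^ q * (x ^ (p ℕ.∸ q) * sum0 q (λ i → signedBinomial q i * (x ^ (q ℕ.∸ i) * y ^ i)))
    ≡⟨ cong (c ^ q *_) (*-distribˡ-sum0 q (x ^ (p ℕ.∸ q)) _) ⟩
  c ^ q * sum0 q (λ i → x ^ (p ℕ.∸ q) * (signedBinomial q i * (x ^ (q ℕ.∸ i) * y ^ i)))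
    ≡⟨ cong (c ^ q *_) (sum0-cong q absorb) ⟩
  c ^ q * sum0 q (λ i → signedBinomial q i * (x ^ (p ℕ.∸ i) * y ^ i)) ∎
  where
  open ≡-Reasoning
  absorb : ∀ i → i ≤ q →
    x ^ (p ℕ.∸ q) * (signedBinomial q i * (x ^ (q ℕ.∸ i) * y ^ i)) ≡ signedBinomial q i * (x ^ (p ℕ.∸ i) * y ^ i)
  absorb i i≤q = begin
    x ^ (p ℕ.∸ q) * (b * (x ^ (q ℕ.∸ i) * y ^ i))     ≡⟨ solve 4 (λ a b u v → a :* (b :* (u :* v)) := b :* ((a :* u) :* v)) refl (x ^ (p ℕ.∸ q)) b (x ^ (q ℕ.∸ i)) (y ^ i) ⟩
    b * ((x ^ (p ℕ.∸ q) * x ^ (q ℕ.∸ i)) * y ^ i)     ≡⟨ cong (λ z → b * (z * y ^ i)) (sym (^-homo-* x (p ℕ.∸ q) (q ℕ.∸ i))) ⟩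
    b * (x ^ (p ℕ.∸ q ℕ.+ (q ℕ.∸ i)) * y ^ i)         ≡⟨ cong (λ k → b * (x ^ k * y ^ i)) p∸q+[q∸i]≡p∸i ⟩
    b * (x ^ (p ℕ.∸ i) * y ^ i)                       ∎
    where
    b = signedBinomial q i
    p∸q+[q∸i]≡p∸i : p ℕ.∸ q ℕ.+ (q ℕ.∸ i) ≡ p ℕ.∸ i
    p∸q+[q∸i]≡p∸i = trans (sym (ℕP.+-∸-assoc (p ℕ.∸ q) i≤q)) (cong (ℕ._∸ i) (ℕP.m∸n+n≡m q≤p))

sum1-sum0-interchange : ∀ n N (w : ℕ → ℚ) E (c : ℕ → ℚ) (T : ℕ → ℕ → ℚ) →
  sum1 n (λ j → w j * (E * sum0 N (λ i → c i * T i j)))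
    ≡ E * sum0 N (λ i → c i * sum1 n (λ j → w j * T i j))
sum1-sum0-interchange n N w E c T = sym (begin
  E * sum0 N (λ i → c i * sum1 n (λ j → w j * T i j))
    ≡⟨ cong (E *_) (sum0-cong N (λ i _ → *-distribˡ-sum1 n (c i) _)) ⟩
  E * sum0 N (λ i → sum1 n (λ j → c i * (w j * T i j)))
    ≡⟨ cong (E *_) (sum0-sum1-comm N n _) ⟩
  E * sum1 n (λ j → sum0 N (λ i → c i * (w j * T i j)))
    ≡⟨ *-distribˡ-sum1 n E _ ⟩
  sum1 n (λ j → E * sum0 N (λ i → c i * (w j * T i j)))
    ≡⟨ sum1-cong n (λ t → cong (E *_) (pull-out (w (suc t)) (λ i → T i (suc t)))) ⟩
  sum1 n (λ j → E * (w j * sum0 N (λ i → c i * T i j)))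
    ≡⟨ sum1-cong n (λ t → solve 3 (λ E w S → E :* (w :* S) := w :* (E :* S)) refl E (w (suc t)) _) ⟩
  sum1 n (λ j → w j * (E * sum0 N (λ i → c i * T i j))) ∎)
  where
  open ≡-Reasoning
  pull-out : ∀ v (f : ℕ → ℚ) → sum0 N (λ i → c i * (v * f i)) ≡ v * sum0 N (λ i → c i * f i)
  pull-out v f = trans
    (sum0-cong N (λ i _ → solve 3 (λ c v f → c :* (v :* f) := v :* (c :* f)) refl (c i) v (f i)))
    (sym (*-distribˡ-sum0 N v _))

G-swap : ∀ n p q r s m → G n p q r s m ≡ G n q p s r m
G-swap n p q r s m = sum1-cong n (λ t →
  cong (λ k → H (suc t) m * recipℕ k) (ℕP.*-comm ((suc t ℕ.+ r) ℕ.^ p) ((suc t ℕ.+ s) ℕ.^ q)))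

G-partial-fractions : ∀ n p q r s m → q ≤ p → r ≢ s →
  G n p q r s m ≡ recipℤ ((+ s ℤ.- + r) ℤ.^ q) * sum0 q (λ i → signedBinomial q i * G n (p ℕ.∸ i) i r s m)
G-partial-fractions n p q r s m q≤p r≢s = begin
  G n p q r s m
    ≡⟨ sum1-cong n (λ t → cong (H (suc t) m *_) (expand t)) ⟩
  sum1 n (λ j → H j m * (c ^ q * sum0 q (λ i → signedBinomial q i * T i j)))
    ≡⟨ sum1-sum0-interchange n q (λ j → H j m) (c ^ q) (signedBinomial q) T ⟩
  c ^ q * sum0 q (λ i → signedBinomial q i * G n (p ℕ.∸ i) i r s m)
    ≡⟨ cong (_* sum0 q (λ i → signedBinomial q i * G n (p ℕ.∸ i) i r s m)) (sym (recipℤ-^ d q)) ⟩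
  recipℤ (d ℤ.^ q) * sum0 q (λ i → signedBinomial q i * G n (p ℕ.∸ i) i r s m) ∎
  where
  open ≡-Reasoning
  d = + s ℤ.- + r
  c = recipℤ d
  T : ℕ → ℕ → ℚ
  T i j = recipℕ ((j ℕ.+ r) ℕ.^ (p ℕ.∸ i) ℕ.* (j ℕ.+ s) ℕ.^ i)
  expand : ∀ t → recipℕ ((suc t ℕ.+ r) ℕ.^ p ℕ.* (suc t ℕ.+ s) ℕ.^ q)
                   ≡ c ^ q * sum0 q (λ i → signedBinomial q i * T i (suc t))
  expand t = begin
    recipℕ (a ℕ.^ p ℕ.* b ℕ.^ q)
      ≡⟨ recipℕ-^*^ a b p q ⟩
    recipℕ a ^ p * recipℕ b ^ q
      ≡⟨ ^-*-^-partial-fractions p q q≤p (recipℕ-partial-fraction t r s r≢s) ⟩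
    c ^ q * sum0 q (λ i → signedBinomial q i * (recipℕ a ^ (p ℕ.∸ i) * recipℕ b ^ i))
      ≡⟨ cong (c ^ q *_) (sum0-cong q (λ i _ → cong (signedBinomial q i *_) (sym (recipℕ-^*^ a b (p ℕ.∸ i) i)))) ⟩
    c ^ q * sum0 q (λ i → signedBinomial q i * T i (suc t)) ∎
    where
    a = suc t ℕ.+ r
    b = suc t ℕ.+ s

G-partial-fractions′ : ∀ n p q r s m → p ≤ q → r ≢ s →
  G n p q r s m ≡ recipℤ ((+ r ℤ.- + s) ℤ.^ p) * sum0 p (λ i → signedBinomial p i * G n i (q ℕ.∸ i) r s m)
G-partial-fractions′ n p q r s m p≤q r≢s = begin
  G n p q r s m
    ≡⟨ G-swap n p q r s m ⟩
  G n q p s r m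
    ≡⟨ G-partial-fractions n q p s r m p≤q (λ s≡r → r≢s (sym s≡r)) ⟩
  e * sum0 p (λ i → signedBinomial p i * G n (q ℕ.∸ i) i s r m)
    ≡⟨ cong (e *_) (sum0-cong p (λ i _ → cong (signedBinomial p i *_) (G-swap n (q ℕ.∸ i) i s r m))) ⟩
  e * sum0 p (λ i → signedBinomial p i * G n i (q ℕ.∸ i) r s m) ∎
  where
  open ≡-Reasoning
  e = recipℤ ((+ r ℤ.- + s) ℤ.^ p)

H-split : ∀ t r m → H (t ℕ.+ r) m ≡ H t m + sum1 r (λ i → recipℕ ((t ℕ.+ i) ℕ.^ m))
H-split t r m = begin
  H (t ℕ.+ r) m                                   ≡⟨ cong (λ k → H k m) (ℕP.+-comm t r) ⟩
  sum1 (r ℕ.+ t) g                                ≡⟨ sum1-split r t g ⟩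
  H t m + sum1 r (λ i → g (i ℕ.+ t))              ≡⟨ cong (λ z → H t m + z) (sum1-cong r (λ i → cong (λ k → recipℕ (k ℕ.^ m)) (ℕP.+-comm (suc i) t))) ⟩
  H t m + sum1 r (λ i → recipℕ ((t ℕ.+ i) ℕ.^ m)) ∎
  where
  open ≡-Reasoning
  g : ℕ → ℚ
  g i = recipℕ (i ℕ.^ m)

-- The powers (·)^0 are kept so that both sides match the summands of G literally.
H-shift-term : ∀ t p r s m →
  H t m * recipℕ ((t ℕ.+ r) ℕ.^ p ℕ.* (t ℕ.+ s) ℕ.^ 0)
    ≡ H (t ℕ.+ r) m * recipℕ ((t ℕ.+ r ℕ.+ 0) ℕ.^ p ℕ.* (t ℕ.+ r ℕ.+ 0) ℕ.^ 0)
      - sum1 r (λ i → recipℕ ((t ℕ.+ i) ℕ.^ m ℕ.* (t ℕ.+ r) ℕ.^ p))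
H-shift-term t p r s m = sym (begin
  H (t ℕ.+ r) m * recipℕ (((t ℕ.+ r) ℕ.+ 0) ℕ.^ p ℕ.* 1) - sum1 r (λ i → recipℕ ((t ℕ.+ i) ℕ.^ m ℕ.* (t ℕ.+ r) ℕ.^ p))
    ≡⟨ cong₂ (λ u v → H (t ℕ.+ r) m * u - v) X≡ (sum1-cong r (λ i → trans (recipℕ-* ((t ℕ.+ suc i) ℕ.^ m) _) (*-comm _ X))) ⟩
  H (t ℕ.+ r) m * X - sum1 r (λ i → X * recipℕ ((t ℕ.+ i) ℕ.^ m))
    ≡⟨ cong₂ (λ u v → u * X - v) (H-split t r m) (sym (*-distribˡ-sum1 r X _)) ⟩
  (H t m + T) * X - X * T
    ≡⟨ solve 3 (λ h T X → (h :+ T) :* X :- X :* T := h :* X) refl (H t m) T X ⟩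
  H t m * X
    ≡⟨ cong (H t m *_) (cong recipℕ (sym (ℕP.*-identityʳ ((t ℕ.+ r) ℕ.^ p)))) ⟩
  H t m * recipℕ ((t ℕ.+ r) ℕ.^ p ℕ.* 1) ∎)
  where
  open ≡-Reasoning
  X = recipℕ ((t ℕ.+ r) ℕ.^ p)
  T = sum1 r (λ i → recipℕ ((t ℕ.+ i) ℕ.^ m))
  X≡ : recipℕ (((t ℕ.+ r) ℕ.+ 0) ℕ.^ p ℕ.* 1) ≡ X
  X≡ = cong recipℕ (trans (ℕP.*-identityʳ _) (cong (ℕ._^ p) (ℕP.+-identityʳ (t ℕ.+ r))))

G-shift : ∀ n p r s m →
  G n p 0 r s m ≡ G (n ℕ.+ r) p 0 0 0 m - G r p 0 0 0 m - sum1 r (λ i → R n m p i r)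
G-shift n p r s m = sym (begin
  G (n ℕ.+ r) p 0 0 0 m - A - sum1 r (λ i → R n m p i r)
    ≡⟨ cong₂ (λ u v → u - A - v) (sum1-split n r F) (sum1-comm r n (λ i j → recipℕ ((j ℕ.+ i) ℕ.^ m ℕ.* (j ℕ.+ r) ℕ.^ p))) ⟩
  (A + S) - A - U
    ≡⟨ solve 3 (λ A S U → (A :+ S) :- A :- U := S :- U) refl A S U ⟩
  S - U
    ≡⟨ sym (sum1-- n _ _) ⟩
  sum1 n (λ j → F (j ℕ.+ r) - sum1 r (λ i → recipℕ ((j ℕ.+ i) ℕ.^ m ℕ.* (j ℕ.+ r) ℕ.^ p)))
    ≡⟨ sum1-cong n (λ t → sym (H-shift-term (suc t) p r s m)) ⟩
  G n p 0 r s m ∎)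
  where
  open ≡-Reasoning
  F : ℕ → ℚ
  F k = H k m * recipℕ ((k ℕ.+ 0) ℕ.^ p ℕ.* (k ℕ.+ 0) ℕ.^ 0)
  A = G r p 0 0 0 m
  S = sum1 n (λ j → F (j ℕ.+ r))
  U = sum1 n (λ j → sum1 r (λ i → recipℕ ((j ℕ.+ i) ℕ.^ m ℕ.* (j ℕ.+ r) ℕ.^ p)))

theorem1 : (m p q r s n : ℕ) → 1 ≤ m → 1 < p ℕ.+ q → 1 ≤ n →
    (q ≡ 0 →
      G n p 0 r s m ≡ G (n ℕ.+ r) p 0 0 0 m - G r p 0 0 0 m - sum1 r (λ i → R n m p i r))
    × (q < p → r ≢ s →
      G n p q r s m ≡ recipℤ ((+ s ℤ.- + r) ℤ.^ q)
        * sum0 q (λ i → ℤtoℚ ((-[1+ 0 ] ℤ.^ i) ℤ.* + (q C i)) * G n (p ℕ.∸ i) i r s m))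
    × (p < q → r ≢ s →
      G n p q r s m ≡ recipℤ ((+ r ℤ.- + s) ℤ.^ p)
        * sum0 p (λ i → ℤtoℚ ((-[1+ 0 ] ℤ.^ i) ℤ.* + (p C i)) * G n i (q ℕ.∸ i) r s m))
theorem1 m p q r s n _ _ _ =
    (λ _ → G-shift n p r s m)
  , (λ q<p r≢s → G-partial-fractions n p q r s m (ℕP.<⇒≤ q<p) r≢s)
  , (λ p<q r≢s → G-partial-fractions′ n p q r s m (ℕP.<⇒≤ p<q) r≢s)
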